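{- Let $p$ be an odd prime and $q=p^r$, $r\ge1$. Let $a,b,c,d,e,f\in\mathbb{F}_q^\times$ be such that $af=ce$, $c^2=-4ab$, and $ab=de$. Let $\#C_{a,b,c,d,e,f}(\mathbb{F}_q)$ be the number of $(x,y)\in\mathbb{F}_q^2$ with $ay^2+bx^2+cxy=d+ex^2y^2+fx^3y$. Then $$\#C_{a,b,c,d,e,f}(\mathbb{F}_q)=\begin{cases}2q-2+(q-1)\varphi(ad), & \text{if } q\equiv1\pmod4,\\ 2q-2-(q-1)\varphi(ad), & \text{if } q\equiv 3\pmod 4.\end{cases}$$
   Context: $\varphi$ denotes the quadratic character of $\mathbb{F}_q^\times$ (i.e. $\varphi(u)=1$ if $u$ is a nonzero square, $-1$ if $u$ is a non-square, and $\varphi(0)=0$). -}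

module Defs where

open import Level using (0ℓ)
open import Data.Nat using (ℕ)
open import Data.Fin using (Fin)
open import Data.Product using (_×_; _,_; ∃)
open import Data.List using (List; map; length; filter; cartesianProduct; allFin)
open import Data.List.Membership.Propositional using (_∈_)
open import Data.List.Relation.Unary.Any using (Any; any?)
open import Data.Integer as ℤ using (ℤ)
open import Relation.Nullary using (¬_; yes; no)
open import Relation.Binary.PropositionalEquality using (_≡_)
open import Relation.Binary.Definitions using (DecidableEquality)
open import Algebra.Core using (Op₁; Op₂)
open import Algebra.Structures using (IsCommutativeRing)
open import Function.Bundles using (_↔_; Inverse)

record FiniteField (q : ℕ) : Set₁ where
  infixl 7 _*_
  infixl 6 _+_
  field
    Carrier : Set
    _+_ _*_ : Op₂ Carrier
    -_ : Op₁ Carrier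
    0# 1# : Carrier
    isCommutativeRing : IsCommutativeRing _≡_ _+_ _*_ -_ 0# 1#
    0≢1 : ¬ (0# ≡ 1#)
    inverse : ∀ x → ¬ (x ≡ 0#) → ∃ λ y → x * y ≡ 1#
    _≟_ : DecidableEquality Carrier
    enum : Fin q ↔ Carrier

  elements : List Carrier
  elements = map (Inverse.to enum) (allFin q)

  four : Carrier
  four = 1# + 1# + 1# + 1#

  φ : Carrier → ℤ
  φ u with u ≟ 0#
  ... | yes _ = ℤ.0ℤ
  ... | no _ with any? (λ t → (t * t) ≟ u) elements
  ... | yes _ = ℤ.1ℤ
  ... | no _ = ℤ.-1ℤ

  #C : (a b c d e f : Carrier) → ℕ
  #C a b c d e f =
    length (filter (λ { (x , y) → (a * (y * y) + b * (x * x) + c * x * y)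
                                     ≟ (d + e * (x * x) * (y * y) + f * (x * x * x) * y) })
                   (cartesianProduct elements elements))

-- Using the three relations among the coefficients,
-- 4ae (L - R) = (a - e x²) B(x, y) with B(x, y) = 4ae y² + 4ce xy + c², so a point lies on the
-- curve iff e x² = a or B(x, y) = 0.  The 1 + φ(ae) vertical lines e x² = a lie entirely on the curve,
-- and on each of them B(x, ·) = (2ex · + c)² has exactly one root; for y ≠ 0, B(·, y) is linear with
-- exactly one root, and B(x, 0) = c² ≠ 0.  Summing over columns, #C = (q - 1)(2 + φ(ae)).  Finally
-- ae (2d)² = -(ad) c², so φ(ae) = φ(-1) φ(ad), and φ(-1) = 1 iff q ≡ 1 (mod 4): the involutions
-- u ↦ -u and u ↦ u⁻¹ of the (q - 1)/2 nonzero squares determine the parity of (q - 1)/2.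
module Submission where

open import Level using (0ℓ)
open import Data.Nat as ℕ using (ℕ; zero; suc; _^_; _%_; _≤_)
import Data.Nat.Properties as ℕ
open import Data.Nat.Divisibility using (_∣_; divides; ∣1⇒≡1)
open import Data.Nat.DivMod using ([m+kn]%n≡m%n)
open import Data.Nat.Primality using (Prime; prime[2]; euclidsLemma; prime⇒irreducible)
import Data.Nat.Tactic.RingSolver as ℕ-Solver
open import Data.Integer as ℤ using (ℤ; 0ℤ; 1ℤ; -1ℤ)
import Data.Integer.Properties as ℤ
open import Data.Fin as Fin using (Fin; zero; suc; punchIn)
open import Data.Fin.Properties using (punchInᵢ≢i; <-cmp; <-asym) renaming (_<?_ to _<ᶠ?_)
open import Data.Fin.Permutation using (permutation)
open import Data.List using (List; _∷_; []; map; length; filter; tabulate; cartesianProduct; allFin; _++_)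
open import Data.List.Membership.Propositional using (_∈_; lose)
open import Data.List.Membership.Propositional.Properties using (∈-map⁺; ∈-allFin)
open import Data.List.Properties using (length-++; filter-++; map-tabulate)
open import Data.List.Relation.Unary.Any using (any?; satisfied)
open import Data.Bool using (if_then_else_)
open import Data.Unit using (⊤; tt)
open import Data.Product using (_×_; _,_; proj₁; proj₂; ∃)
open import Data.Sum using (_⊎_; inj₁; inj₂; [_,_]′)
open import Function using (_∘_; id; flip; _↔_; Inverse)
open import Relation.Binary.Definitions using (DecidableEquality; tri<; tri≈; tri>)
open import Relation.Nullary using (Dec; yes; no; does; ¬_; contradiction)
open import Relation.Nullary.Decidable using (map′; ¬?; _×-dec_)
open import Relation.Unary using (Pred; Decidable; _⊆_; _≐_; _∩_; ∁)
open import Relation.Unary.Properties using (_∩?_; ∁?; U?)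
open import Relation.Binary.PropositionalEquality
open import Algebra.Bundles using (CommutativeRing)
open import Defs

module _ where
  open import Data.Nat using (_+_; _*_)
  open import Algebra.Properties.Semiring.Sum ℕ.+-*-semiring
    using (sum; sum-cong-≗; sum-remove; sum-replicate-zero; ∑-distrib-+; ∑-comm; *-distribˡ-sum; sum-permute)

  private variable
    A B : Set
    m : ℕ

  indicator : {P : Set} → Dec P → ℕ
  indicator P? = if does P? then 1 else 0

  indicator-split : {P Q : Set} (P? : Dec P) (Q? : Dec Q) →
    indicator P? ≡ indicator (P? ×-dec Q?) + indicator (P? ×-dec ¬? Q?)
  indicator-split (yes _) (yes _) = refl
  indicator-split (yes _) (no _)  = refl
  indicator-split (no _)  _       = refl

  sum-const-1 : ∀ m → sum {m} (λ _ → 1) ≡ m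
  sum-const-1 zero    = refl
  sum-const-1 (suc m) = cong suc (sum-const-1 m)

  term≤sum : (t : Fin m → ℕ) (i : Fin m) → t i ≤ sum t
  term≤sum {suc m} t i = ℕ.≤-trans (ℕ.m≤m+n (t i) _) (ℕ.≤-reflexive (sym (sum-remove t)))

  sum-supported-at : (t : Fin m → ℕ) (i : Fin m) → (∀ j → j ≢ i → t j ≡ 0) → sum t ≡ t i
  sum-supported-at {suc m} t i t≡0 = begin
    sum t                              ≡⟨ sum-remove t ⟩
    t i + sum (λ j → t (punchIn i j))  ≡⟨ cong (t i +_) (sum-cong-≗ (λ j → t≡0 _ (punchInᵢ≢i i j))) ⟩
    t i + sum {m} (λ _ → 0)            ≡⟨ cong (t i +_) (sum-replicate-zero m) ⟩
    t i + 0                            ≡⟨ ℕ.+-identityʳ (t i) ⟩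
    t i                                ∎
    where open ≡-Reasoning

  length-filter-tabulate : {P : Pred A 0ℓ} (P? : Decidable P) (f : Fin m → A) →
    length (filter P? (tabulate f)) ≡ sum (indicator ∘ P? ∘ f)
  length-filter-tabulate {m = zero}  P? f = refl
  length-filter-tabulate {m = suc m} P? f with P? (f zero)
  ... | yes _ = cong suc (length-filter-tabulate P? (f ∘ suc))
  ... | no _  = length-filter-tabulate P? (f ∘ suc)

  length-filter-map : {P : Pred B 0ℓ} (P? : Decidable P) (g : A → B) (xs : List A) →
    length (filter P? (map g xs)) ≡ length (filter (P? ∘ g) xs)
  length-filter-map P? g [] = refl
  length-filter-map P? g (x ∷ xs) with P? (g x)
  ... | yes _ = cong suc (length-filter-map P? g xs)
  ... | no _  = length-filter-map P? g xs

  length-filter-cartesianProduct : {P : Pred (A × B) 0ℓ} (P? : Decidable P) (f : Fin m → A) (ys : List B) →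
    length (filter P? (cartesianProduct (tabulate f) ys)) ≡ sum (λ i → length (filter (λ y → P? (f i , y)) ys))
  length-filter-cartesianProduct {m = zero}  P? f ys = refl
  length-filter-cartesianProduct {m = suc m} P? f ys = begin
    length (filter P? (map (f zero ,_) ys ++ cartesianProduct (tabulate (f ∘ suc)) ys))
      ≡⟨ cong length (filter-++ P? (map (f zero ,_) ys) _) ⟩
    length (filter P? (map (f zero ,_) ys) ++ filter P? (cartesianProduct (tabulate (f ∘ suc)) ys))
      ≡⟨ length-++ (filter P? (map (f zero ,_) ys)) ⟩
    length (filter P? (map (f zero ,_) ys)) + length (filter P? (cartesianProduct (tabulate (f ∘ suc)) ys))
      ≡⟨ cong₂ _+_ (length-filter-map P? (f zero ,_) ys) (length-filter-cartesianProduct P? (f ∘ suc) ys) ⟩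
    sum (λ i → length (filter (λ y → P? (f i , y)) ys))
      ∎
    where open ≡-Reasoning

  module Counting {n : ℕ} (enumeration : Fin n ↔ A) (_≟_ : DecidableEquality A) where

    open Inverse enumeration using (to; from; strictlyInverseˡ; strictlyInverseʳ)

    elements : List A
    elements = map to (allFin n)

    ∑ : (A → ℕ) → ℕ
    ∑ f = sum (f ∘ to)

    count : {P : Pred A 0ℓ} → Decidable P → ℕ
    count P? = ∑ (indicator ∘ P?)

    private variable
      P Q : Pred A 0ℓ

    ∑-cong : {f g : A → ℕ} → (∀ x → f x ≡ g x) → ∑ f ≡ ∑ g
    ∑-cong f≗g = sum-cong-≗ (f≗g ∘ to)

    ∑-+ : (f g : A → ℕ) → ∑ (λ x → f x + g x) ≡ ∑ f + ∑ g
    ∑-+ f g = ∑-distrib-+ (f ∘ to) (g ∘ to)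

    ∑-*ˡ : (k : ℕ) (f : A → ℕ) → ∑ (λ x → k * f x) ≡ k * ∑ f
    ∑-*ˡ k f = sym (*-distribˡ-sum k (f ∘ to))

    ∑-swap : (h : A → A → ℕ) → ∑ (λ x → ∑ (h x)) ≡ ∑ (λ y → ∑ (λ x → h x y))
    ∑-swap h = ∑-comm (λ i j → h (to i) (to j))

    ∑-1 : ∑ (λ _ → 1) ≡ n
    ∑-1 = sum-const-1 n

    ∑-∘-bijection : (f : A → ℕ) (σ τ : A → A) → (∀ x → σ (τ x) ≡ x) → (∀ x → τ (σ x) ≡ x) →
      ∑ (f ∘ σ) ≡ ∑ f
    ∑-∘-bijection f σ τ στ τσ = sym (begin
      sum (f ∘ to)                          ≡⟨ sum-permute (f ∘ to) π ⟩
      sum (λ i → f (to (from (σ (to i)))))  ≡⟨ sum-cong-≗ (λ i → cong f (strictlyInverseˡ (σ (to i)))) ⟩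
      sum (f ∘ σ ∘ to)                      ∎)
      where
      open ≡-Reasoning
      conjugate-inverse : ∀ {σ τ : A → A} → (∀ x → σ (τ x) ≡ x) → ∀ i → from (σ (to (from (τ (to i))))) ≡ i
      conjugate-inverse {σ} {τ} στ i = begin
        from (σ (to (from (τ (to i))))) ≡⟨ cong (from ∘ σ) (strictlyInverseˡ (τ (to i))) ⟩
        from (σ (τ (to i)))             ≡⟨ cong from (στ (to i)) ⟩
        from (to i)                     ≡⟨ strictlyInverseʳ i ⟩
        i                               ∎
      π = permutation (from ∘ σ ∘ to) (from ∘ τ ∘ to) (conjugate-inverse {σ} {τ} στ) (conjugate-inverse {τ} {σ} τσ)

    count-cong : (P? : Decidable P) (Q? : Decidable Q) → P ≐ Q → count P? ≡ count Q?
    count-cong P? Q? (P⊆Q , Q⊆P) = ∑-cong same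
      where
      same : ∀ x → indicator (P? x) ≡ indicator (Q? x)
      same x with P? x | Q? x
      ... | yes _  | yes _  = refl
      ... | no _   | no _   = refl
      ... | yes px | no ¬qx = contradiction (P⊆Q px) ¬qx
      ... | no ¬px | yes qx = contradiction (Q⊆P qx) ¬px

    count-split : (P? : Decidable P) (Q? : Decidable Q) → count P? ≡ count (P? ∩? Q?) + count (P? ∩? ∁? Q?)
    count-split P? Q? = trans (∑-cong (λ x → indicator-split (P? x) (Q? x)))
      (∑-+ (indicator ∘ (P? ∩? Q?)) (indicator ∘ (P? ∩? ∁? Q?)))

    count-∘-bijection : (P? : Decidable P) (σ τ : A → A) → (∀ x → σ (τ x) ≡ x) → (∀ x → τ (σ x) ≡ x) →
      count (P? ∘ σ) ≡ count P?
    count-∘-bijection P? = ∑-∘-bijection (indicator ∘ P?)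

    count-all : (P? : Decidable P) → (∀ x → P x) → count P? ≡ n
    count-all P? all = trans (∑-cong one) ∑-1
      where
      one : ∀ x → indicator (P? x) ≡ 1
      one x with P? x
      ... | yes _  = refl
      ... | no ¬px = contradiction (all x) ¬px

    count-none : (P? : Decidable P) → (∀ x → ¬ P x) → count P? ≡ 0
    count-none P? none = trans (∑-cong vanishes) (sum-replicate-zero n)
      where
      vanishes : ∀ x → indicator (P? x) ≡ 0
      vanishes x with P? x
      ... | yes px = contradiction px (none x)
      ... | no _   = refl

    count≡0⇒none : (P? : Decidable P) → count P? ≡ 0 → ∀ x → ¬ P x
    count≡0⇒none {P = P} P? count≡0 x px with P? (to (from x)) | term≤sum (indicator ∘ P? ∘ to) (from x)
    ... | yes _    | 1≤count = contradiction (subst (1 ≤_) count≡0 1≤count) λ ()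
    ... | no ¬ptfx | _       = ¬ptfx (subst P (sym (strictlyInverseˡ x)) px)

    count-singleton : (z : A) → count (z ≟_) ≡ 1
    count-singleton z = begin
      sum (indicator ∘ (z ≟_) ∘ to)  ≡⟨ sum-supported-at _ (from z) elsewhere ⟩
      indicator (z ≟ to (from z))    ≡⟨ hit ⟩
      1                              ∎
      where
      open ≡-Reasoning
      hit : indicator (z ≟ to (from z)) ≡ 1
      hit with z ≟ to (from z)
      ... | yes _ = refl
      ... | no z≢ = contradiction (sym (strictlyInverseˡ z)) z≢
      elsewhere : ∀ i → i ≢ from z → indicator (z ≟ to i) ≡ 0
      elsewhere i i≢ with z ≟ to i
      ... | yes z≡ = contradiction (trans (sym (strictlyInverseʳ i)) (cong from (sym z≡))) i≢
      ... | no _   = refl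

    count-complement : (P? : Decidable P) → count P? + count (∁? P?) ≡ n
    count-complement P? = trans (sym (∑-+ (indicator ∘ P?) (indicator ∘ ∁? P?))) (trans (∑-cong one) ∑-1)
      where
      one : ∀ x → indicator (P? x) + indicator (∁? P? x) ≡ 1
      one x with P? x
      ... | yes _ = refl
      ... | no _  = refl

    count-pair : (P? : Decidable P) {u v : A} → u ≢ v → P ≐ (λ x → u ≡ x ⊎ v ≡ x) → count P? ≡ 2
    count-pair {P} P? {u} {v} u≢v (P⊆ , ⊆P) = begin
      count P?                                         ≡⟨ count-split P? (u ≟_) ⟩
      count (P? ∩? (u ≟_)) + count (P? ∩? ∁? (u ≟_))   ≡⟨ cong₂ _+_ (count-cong (P? ∩? (u ≟_)) (u ≟_) (proj₂ , λ u≡x → ⊆P (inj₁ u≡x) , u≡x))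
                                                                    (count-cong (P? ∩? ∁? (u ≟_)) (v ≟_) (at-v , λ v≡x → ⊆P (inj₂ v≡x) , λ u≡x → u≢v (trans u≡x (sym v≡x)))) ⟩
      count (u ≟_) + count (v ≟_)                      ≡⟨ cong₂ _+_ (count-singleton u) (count-singleton v) ⟩
      2                                                ∎
      where
      open ≡-Reasoning
      at-v : P ∩ ∁ (u ≡_) ⊆ (v ≡_)
      at-v (px , u≢x) with P⊆ px
      ... | inj₁ u≡x = contradiction u≡x u≢x
      ... | inj₂ v≡x = v≡x

    ⊆∧count-≡⇒⊇ : (P? : Decidable P) (Q? : Decidable Q) → P ⊆ Q → count P? ≡ count Q? → Q ⊆ P
    ⊆∧count-≡⇒⊇ P? Q? P⊆Q #P≡#Q {x} qx with P? x
    ... | yes px = px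
    ... | no ¬px = contradiction (qx , ¬px) (count≡0⇒none (Q? ∩? ∁? P?) rest≡0 x)
      where
      open ≡-Reasoning
      rest≡0 : count (Q? ∩? ∁? P?) ≡ 0
      rest≡0 = ℕ.+-cancelˡ-≡ (count P?) (count (Q? ∩? ∁? P?)) 0 (begin
        count P? + count (Q? ∩? ∁? P?)         ≡⟨ cong (_+ count (Q? ∩? ∁? P?)) (count-cong P? (Q? ∩? P?) ((λ p → P⊆Q p , p) , proj₂)) ⟩
        count (Q? ∩? P?) + count (Q? ∩? ∁? P?) ≡⟨ count-split Q? P? ⟨
        count Q?                               ≡⟨ #P≡#Q ⟨
        count P?                               ≡⟨ ℕ.+-identityʳ (count P?) ⟨
        count P? + 0                           ∎)

    -- Each orbit {x , σ x} is counted once, by the member with the smaller index.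
    count-involution : (P? : Decidable P) (σ : A → A) → (∀ x → σ (σ x) ≡ x) →
      (∀ {x} → P x → P (σ x)) → (∀ {x} → P x → σ x ≢ x) → 2 ∣ count P?
    count-involution {P} P? σ σσ P-σ no-fixed-point = divides h (begin
      count P?                                  ≡⟨ count-split P? before? ⟩
      h + count (P? ∩? ∁? before?)              ≡⟨ cong (h +_) (count-cong (P? ∩? ∁? before?) ((P? ∩? before?) ∘ σ) (swap , unswap)) ⟩
      h + count ((P? ∩? before?) ∘ σ)           ≡⟨ cong (h +_) (count-∘-bijection (P? ∩? before?) σ σ σσ σσ) ⟩
      h + h                                     ≡⟨ cong (h +_) (ℕ.+-identityʳ h) ⟨
      2 * h                                     ≡⟨ ℕ.*-comm 2 h ⟩
      h * 2                                     ∎)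
      where
      open ≡-Reasoning
      Before : Pred A 0ℓ
      Before x = from x Fin.< from (σ x)
      before? : Decidable Before
      before? x = from x <ᶠ? from (σ x)
      h : ℕ
      h = count (P? ∩? before?)
      swap : P ∩ ∁ Before ⊆ (P ∩ Before) ∘ σ
      swap {x} (px , x≮σx) with <-cmp (from x) (from (σ x))
      ... | tri< x<σx _ _ = contradiction x<σx x≮σx
      ... | tri≈ _ x≡σx _ = contradiction (trans (sym (strictlyInverseˡ (σ x))) (trans (cong to (sym x≡σx)) (strictlyInverseˡ x))) (no-fixed-point px)
      ... | tri> _ _ σx<x = P-σ px , subst (λ y → from (σ x) Fin.< from y) (sym (σσ x)) σx<x
      unswap : (P ∩ Before) ∘ σ ⊆ P ∩ ∁ Before
      unswap {x} (pσx , σx<σσx) = subst P (σσ x) (P-σ pσx) , <-asym (subst (λ y → from (σ x) Fin.< from y) (σσ x) σx<σσx)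

    ∑-count-fibres : (g : A → A) → ∑ (λ y → count (λ x → g x ≟ y)) ≡ n
    ∑-count-fibres g = begin
      ∑ (λ y → count (λ x → g x ≟ y))   ≡⟨ ∑-swap (λ x y → indicator (g x ≟ y)) ⟨
      ∑ (λ x → count (g x ≟_))          ≡⟨ ∑-cong (λ x → count-singleton (g x)) ⟩
      ∑ (λ _ → 1)                       ≡⟨ ∑-1 ⟩
      n                                 ∎
      where open ≡-Reasoning

    ∈-elements : ∀ x → x ∈ elements
    ∈-elements x = subst (_∈ elements) (strictlyInverseˡ x) (∈-map⁺ to (∈-allFin (from x)))

    elements≡tabulate : elements ≡ tabulate to
    elements≡tabulate = map-tabulate id to

    length-filter-elements : (P? : Decidable P) → length (filter P? elements) ≡ count P?
    length-filter-elements P? = trans (cong (length ∘ filter P?) elements≡tabulate) (length-filter-tabulate P? to)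

    length-filter-elements² : {R : Pred (A × A) 0ℓ} (R? : Decidable R) →
      length (filter R? (cartesianProduct elements elements)) ≡ ∑ (λ x → count (λ y → R? (x , y)))
    length-filter-elements² R? = begin
      length (filter R? (cartesianProduct elements elements))
        ≡⟨ cong (λ xs → length (filter R? (cartesianProduct xs elements))) elements≡tabulate ⟩
      length (filter R? (cartesianProduct (tabulate to) elements))
        ≡⟨ length-filter-cartesianProduct R? to elements ⟩
      ∑ (λ x → length (filter (λ y → R? (x , y)) elements))
        ≡⟨ ∑-cong (λ x → length-filter-elements (λ y → R? (x , y))) ⟩
      ∑ (λ x → count (λ y → R? (x , y)))
        ∎
      where open ≡-Reasoning

prime≢2⇒2∤p^r : ∀ {p} → Prime p → p ≢ 2 → ∀ r → ¬ 2 ∣ p ^ r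
prime≢2⇒2∤p^r p-prime p≢2 zero 2∣1 = contradiction (∣1⇒≡1 2∣1) λ ()
prime≢2⇒2∤p^r {p} p-prime p≢2 (suc r) 2∣pʳ⁺¹ with euclidsLemma p (p ^ r) prime[2] 2∣pʳ⁺¹
... | inj₂ 2∣pʳ = prime≢2⇒2∤p^r p-prime p≢2 r 2∣pʳ
... | inj₁ 2∣p with prime⇒irreducible p-prime 2∣p
...   | inj₁ ()
...   | inj₂ 2≡p = p≢2 (sym 2≡p)

[1+2*[h*2]]%4≡1 : ∀ h → (1 ℕ.+ 2 ℕ.* (h ℕ.* 2)) ℕ.% 4 ≡ 1
[1+2*[h*2]]%4≡1 h = trans (cong (ℕ._% 4) (regroup h)) ([m+kn]%n≡m%n 1 h 4)
  where
  regroup : ∀ h → 1 ℕ.+ 2 ℕ.* (h ℕ.* 2) ≡ 1 ℕ.+ h ℕ.* 4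
  regroup = ℕ-Solver.solve-∀

[1+2*[1+h*2]]%4≡3 : ∀ h → (1 ℕ.+ 2 ℕ.* (1 ℕ.+ h ℕ.* 2)) ℕ.% 4 ≡ 3
[1+2*[1+h*2]]%4≡3 h = trans (cong (ℕ._% 4) (regroup h)) ([m+kn]%n≡m%n 3 h 4)
  where
  regroup : ∀ h → 1 ℕ.+ 2 ℕ.* (1 ℕ.+ h ℕ.* 2) ≡ 3 ℕ.+ h ℕ.* 4
  regroup = ℕ-Solver.solve-∀

module _ where
  open import Data.Integer using (+_; _+_; _-_; _*_)
  import Data.Integer.Tactic.RingSolver as ℤ-Solver
  open ≡-Reasoning

  +[k+k*m]≡[q-1]*[2+z] : ∀ {q k m} z → q ≡ suc k → + m ≡ 1ℤ + z → + (k ℕ.+ k ℕ.* m) ≡ (+ q - 1ℤ) * (+ 2 + z)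
  +[k+k*m]≡[q-1]*[2+z] {k = k} {m} z refl m≡1+z = begin
    + (k ℕ.+ k ℕ.* m)                 ≡⟨ ℤ.pos-+ k (k ℕ.* m) ⟩
    + k + + (k ℕ.* m)                 ≡⟨ cong (λ n → + k + n) (ℤ.pos-* k m) ⟩
    + k + + k * + m                   ≡⟨ cong (λ n → + k + + k * n) m≡1+z ⟩
    + k + + k * (1ℤ + z)              ≡⟨ rearrange (+ k) z ⟩
    (1ℤ + + k - 1ℤ) * (+ 2 + z)       ≡⟨ cong (λ n → (n - 1ℤ) * (+ 2 + z)) (ℤ.pos-+ 1 k) ⟨
    (+ suc k - 1ℤ) * (+ 2 + z)        ∎
    where
    rearrange : ∀ K z → K + K * (1ℤ + z) ≡ (1ℤ + K - 1ℤ) * (+ 2 + z)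
    rearrange = ℤ-Solver.solve-∀

  [q-1]*[2+z]≡[2q-2]+[q-1]*z : ∀ q z → (+ q - 1ℤ) * (+ 2 + 1ℤ * z) ≡ (+ (2 ℕ.* q) - + 2) + (+ q - + 1) * z
  [q-1]*[2+z]≡[2q-2]+[q-1]*z q z = trans (expand (+ q) z) (cong (λ n → (n - + 2) + (+ q - + 1) * z) (sym (ℤ.pos-* 2 q)))
    where
    expand : ∀ Q z → (Q - 1ℤ) * (+ 2 + 1ℤ * z) ≡ (+ 2 * Q - + 2) + (Q - + 1) * z
    expand = ℤ-Solver.solve-∀

  [q-1]*[2-z]≡[2q-2]-[q-1]*z : ∀ q z → (+ q - 1ℤ) * (+ 2 + -1ℤ * z) ≡ (+ (2 ℕ.* q) - + 2) - (+ q - + 1) * z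
  [q-1]*[2-z]≡[2q-2]-[q-1]*z q z = trans (expand (+ q) z) (cong (λ n → (n - + 2) - (+ q - + 1) * z) (sym (ℤ.pos-* 2 q)))
    where
    expand : ∀ Q z → (Q - 1ℤ) * (+ 2 + -1ℤ * z) ≡ (+ 2 * Q - + 2) - (Q - + 1) * z
    expand = ℤ-Solver.solve-∀

module FiniteFieldProperties {q : ℕ} (F : FiniteField q) where

  open FiniteField F
  open Counting enum _≟_ hiding (elements)

  commutativeRing : CommutativeRing 0ℓ 0ℓ
  commutativeRing = record { isCommutativeRing = isCommutativeRing }

  open CommutativeRing commutativeRing
    using (+-assoc; +-identityʳ; -‿inverseˡ; -‿inverseʳ; *-assoc; *-comm; *-identityˡ; *-identityʳ;
           distribʳ; zeroˡ; zeroʳ; ring; commutativeSemiring)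
  open import Algebra.Properties.Ring ring
    using (-‿involutive; -‿distribˡ-*; -‿distribʳ-*; -1*x≈-x; -0#≈0#; +-cancelˡ; +-cancelʳ; +-inverseˡ-unique)
  open import Algebra.Solver.Ring.NaturalCoefficients.Default commutativeSemiring
    using (solve; _:=_; _:+_; _:*_; con)

  private variable
    u w x y z : Carrier

  1≢0 : 1# ≢ 0#
  1≢0 = 0≢1 ∘ sym

  -- Inversion is made total by the junk value 0# ⁻¹ = 0#.
  _⁻¹ : Carrier → Carrier
  x ⁻¹ with x ≟ 0#
  ... | yes _   = 0#
  ... | no x≢0 = proj₁ (inverse x x≢0)

  0⁻¹≡0 : 0# ⁻¹ ≡ 0#
  0⁻¹≡0 with 0# ≟ 0#
  ... | yes _   = refl
  ... | no 0≢0 = contradiction refl 0≢0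

  x*x⁻¹≡1 : x ≢ 0# → x * x ⁻¹ ≡ 1#
  x*x⁻¹≡1 {x} x≢0 with x ≟ 0#
  ... | yes x≡0 = contradiction x≡0 x≢0
  ... | no x≢0  = proj₂ (inverse x x≢0)

  x⁻¹*x≡1 : x ≢ 0# → x ⁻¹ * x ≡ 1#
  x⁻¹*x≡1 {x} x≢0 = trans (*-comm (x ⁻¹) x) (x*x⁻¹≡1 x≢0)

  x*[x⁻¹*y]≡y : x ≢ 0# → x * (x ⁻¹ * y) ≡ y
  x*[x⁻¹*y]≡y {x} {y} x≢0 = trans (sym (*-assoc x (x ⁻¹) y)) (trans (cong (_* y) (x*x⁻¹≡1 x≢0)) (*-identityˡ y))

  x⁻¹*[x*y]≡y : x ≢ 0# → x ⁻¹ * (x * y) ≡ y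
  x⁻¹*[x*y]≡y {x} {y} x≢0 = trans (sym (*-assoc (x ⁻¹) x y)) (trans (cong (_* y) (x⁻¹*x≡1 x≢0)) (*-identityˡ y))

  *-cancelˡ-≢0 : x ≢ 0# → x * y ≡ x * z → y ≡ z
  *-cancelˡ-≢0 {x} {y} {z} x≢0 xy≡xz = begin
    y               ≡⟨ x⁻¹*[x*y]≡y x≢0 ⟨
    x ⁻¹ * (x * y)  ≡⟨ cong (x ⁻¹ *_) xy≡xz ⟩
    x ⁻¹ * (x * z)  ≡⟨ x⁻¹*[x*y]≡y x≢0 ⟩
    z               ∎
    where open ≡-Reasoning

  x*y≡0⇒x≡0⊎y≡0 : x * y ≡ 0# → x ≡ 0# ⊎ y ≡ 0#
  x*y≡0⇒x≡0⊎y≡0 {x} {y} xy≡0 with x ≟ 0#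
  ... | yes x≡0 = inj₁ x≡0
  ... | no x≢0  = inj₂ (*-cancelˡ-≢0 x≢0 (trans xy≡0 (sym (zeroʳ x))))

  *-≢0 : x ≢ 0# → y ≢ 0# → x * y ≢ 0#
  *-≢0 x≢0 y≢0 xy≡0 = [ x≢0 , y≢0 ]′ (x*y≡0⇒x≡0⊎y≡0 xy≡0)

  *-cancelʳ-⊎ : x * z ≡ y * z → x ≡ y ⊎ z ≡ 0#
  *-cancelʳ-⊎ {x} {z} {y} xz≡yz with z ≟ 0#
  ... | yes z≡0 = inj₂ z≡0
  ... | no z≢0  = inj₁ (*-cancelˡ-≢0 z≢0 (trans (*-comm z x) (trans xz≡yz (*-comm y z))))

  x⁻¹≢0 : x ≢ 0# → x ⁻¹ ≢ 0#
  x⁻¹≢0 {x} x≢0 x⁻¹≡0 = 1≢0 (trans (sym (x*x⁻¹≡1 x≢0)) (trans (cong (x *_) x⁻¹≡0) (zeroʳ x)))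

  ⁻¹-involutive : x ⁻¹ ⁻¹ ≡ x
  ⁻¹-involutive {x} = by-cases (x ≟ 0#)
    where
    by-cases : Dec (x ≡ 0#) → x ⁻¹ ⁻¹ ≡ x
    by-cases (yes refl) = trans (cong _⁻¹ 0⁻¹≡0) 0⁻¹≡0
    by-cases (no x≢0)   = *-cancelˡ-≢0 (x⁻¹≢0 x≢0) (trans (x*x⁻¹≡1 (x⁻¹≢0 x≢0)) (sym (x⁻¹*x≡1 x≢0)))

  1⁻¹≡1 : 1# ⁻¹ ≡ 1#
  1⁻¹≡1 = *-cancelˡ-≢0 1≢0 (trans (x*x⁻¹≡1 1≢0) (sym (*-identityʳ 1#)))

  -x≢0 : x ≢ 0# → - x ≢ 0#
  -x≢0 {x} x≢0 -x≡0 = x≢0 (trans (sym (-‿involutive x)) (trans (cong -_ -x≡0) -0#≈0#))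

  -x*-y≡x*y : - x * - y ≡ x * y
  -x*-y≡x*y {x} {y} = begin
    - x * - y    ≡⟨ -‿distribˡ-* x (- y) ⟨
    - (x * - y)  ≡⟨ cong -_ (-‿distribʳ-* x y) ⟨
    - - (x * y)  ≡⟨ -‿involutive (x * y) ⟩
    x * y        ∎
    where open ≡-Reasoning

  [x-y]*[x+y]≡x*x-y*y : (x + - y) * (x + y) ≡ x * x + - (y * y)
  [x-y]*[x+y]≡x*x-y*y {x} {y} = begin
    (x + - y) * (x + y)              ≡⟨ solve 3 (λ x y y′ → (x :+ y′) :* (x :+ y) := x :* x :+ y′ :* y :+ x :* (y′ :+ y)) refl x y (- y) ⟩
    x * x + - y * y + x * (- y + y)  ≡⟨ cong₂ (λ s t → x * x + s + x * t) (sym (-‿distribˡ-* y y)) (-‿inverseˡ y) ⟩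
    x * x + - (y * y) + x * 0#       ≡⟨ cong (x * x + - (y * y) +_) (zeroʳ x) ⟩
    x * x + - (y * y) + 0#           ≡⟨ +-identityʳ _ ⟩
    x * x + - (y * y)                ∎
    where open ≡-Reasoning

  x*x≡y*y⇒y≡x⊎-y≡x : x * x ≡ y * y → y ≡ x ⊎ - y ≡ x
  x*x≡y*y⇒y≡x⊎-y≡x {x} {y} xx≡yy
    with x*y≡0⇒x≡0⊎y≡0 (trans [x-y]*[x+y]≡x*x-y*y (trans (cong (_+ - (y * y)) xx≡yy) (-‿inverseʳ (y * y))))
  ... | inj₁ x-y≡0 = inj₁ (sym (+-cancelʳ (- y) x y (trans x-y≡0 (sym (-‿inverseʳ y)))))
  ... | inj₂ x+y≡0 = inj₂ (sym (+-inverseˡ-unique x y x+y≡0))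

  y≡x⊎-y≡x⇒x*x≡y*y : y ≡ x ⊎ - y ≡ x → x * x ≡ y * y
  y≡x⊎-y≡x⇒x*x≡y*y (inj₁ refl) = refl
  y≡x⊎-y≡x⇒x*x≡y*y (inj₂ refl) = -x*-y≡x*y

  2# : Carrier
  2# = 1# + 1#

  x+x≡2#*x : x + x ≡ 2# * x
  x+x≡2#*x {x} = sym (trans (distribʳ x 1# 1#) (cong₂ _+_ (*-identityˡ x) (*-identityˡ x)))

  four≡2#*2# : four ≡ 2# * 2#
  four≡2#*2# = trans (+-assoc 2# 1# 1#) x+x≡2#*x

  #nonzero : ℕ
  #nonzero = count (∁? (0# ≟_))

  q≡1+#nonzero : q ≡ 1 ℕ.+ #nonzero
  q≡1+#nonzero = trans (sym (count-complement (0# ≟_))) (cong (ℕ._+ #nonzero) (count-singleton 0#))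

  count-linear-roots : ∀ {α} β → α ≢ 0# → count (λ y → (α * y + β) ≟ 0#) ≡ 1
  count-linear-roots {α} β α≢0 = trans (count-cong (λ y → (α * y + β) ≟ 0#) (root ≟_) (to-root , from-root)) (count-singleton root)
    where
    root : Carrier
    root = α ⁻¹ * - β
    α*root≡-β : α * root ≡ - β
    α*root≡-β = x*[x⁻¹*y]≡y α≢0
    to-root : ∀ {y} → α * y + β ≡ 0# → root ≡ y
    to-root αy+β≡0 = *-cancelˡ-≢0 α≢0 (trans α*root≡-β (sym (+-inverseˡ-unique _ β αy+β≡0)))
    from-root : ∀ {y} → root ≡ y → α * y + β ≡ 0#
    from-root refl = trans (cong (_+ β) α*root≡-β) (-‿inverseˡ β)

  IsSquare : Pred Carrier 0ℓ
  IsSquare u = ∃ λ t → t * t ≡ u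

  square? : Decidable IsSquare
  square? u = map′ satisfied (λ (t , tt≡u) → lose (∈-elements t) tt≡u) (any? (λ t → (t * t) ≟ u) elements)

  NonzeroSquare : Pred Carrier 0ℓ
  NonzeroSquare = IsSquare ∩ ∁ (0# ≡_)

  nonzeroSquare? : Decidable NonzeroSquare
  nonzeroSquare? = square? ∩? ∁? (0# ≟_)

  φ-0 : φ 0# ≡ 0ℤ
  φ-0 with 0# ≟ 0#
  ... | yes _   = refl
  ... | no 0≢0 = contradiction refl 0≢0

  φ-square : NonzeroSquare u → φ u ≡ 1ℤ
  φ-square {u} ((t , tt≡u) , 0≢u) with u ≟ 0#
  ... | yes u≡0 = contradiction (sym u≡0) 0≢u
  ... | no _ with any? (λ t → (t * t) ≟ u) elements
  ... | yes _       = refl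
  ... | no ¬square = contradiction (lose (∈-elements t) tt≡u) ¬square

  φ-nonsquare : ¬ IsSquare u → φ u ≡ -1ℤ
  φ-nonsquare {u} ¬square with u ≟ 0#
  ... | yes u≡0 = contradiction (0# , trans (zeroˡ 0#) (sym u≡0)) ¬square
  ... | no _ with any? (λ t → (t * t) ≟ u) elements
  ... | yes square = contradiction (satisfied square) ¬square
  ... | no _       = refl

  square-* : IsSquare u → IsSquare w → IsSquare (u * w)
  square-* (s , refl) (t , refl) = s * t , solve 2 (λ s t → (s :* t) :* (s :* t) := (s :* s) :* (t :* t)) refl s t

  square-*-cancelʳ : NonzeroSquare w → IsSquare (u * w) → IsSquare u
  square-*-cancelʳ {w} {u} ((t , refl) , 0≢tt) (s , ss≡u*tt) = s * t ⁻¹ , (begin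
    (s * t ⁻¹) * (s * t ⁻¹)          ≡⟨ solve 2 (λ s i → (s :* i) :* (s :* i) := (s :* s) :* (i :* i)) refl s (t ⁻¹) ⟩
    (s * s) * (t ⁻¹ * t ⁻¹)          ≡⟨ cong (_* (t ⁻¹ * t ⁻¹)) ss≡u*tt ⟩
    (u * (t * t)) * (t ⁻¹ * t ⁻¹)    ≡⟨ solve 3 (λ u t i → (u :* (t :* t)) :* (i :* i) := u :* ((t :* i) :* (t :* i))) refl u t (t ⁻¹) ⟩
    u * ((t * t ⁻¹) * (t * t ⁻¹))    ≡⟨ cong (λ r → u * (r * r)) (x*x⁻¹≡1 t≢0) ⟩
    u * (1# * 1#)                    ≡⟨ cong (u *_) (*-identityʳ 1#) ⟩
    u * 1#                           ≡⟨ *-identityʳ u ⟩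
    u                                ∎)
    where
    open ≡-Reasoning
    t≢0 : t ≢ 0#
    t≢0 t≡0 = 0≢tt (sym (trans (cong (_* t) t≡0) (zeroˡ t)))

  count-roots-0 : count (λ x → (x * x) ≟ 0#) ≡ 1
  count-roots-0 = trans (count-cong (λ x → (x * x) ≟ 0#) (0# ≟_) (to , from)) (count-singleton 0#)
    where
    to : ∀ {x} → x * x ≡ 0# → 0# ≡ x
    to xx≡0 = sym ([ id , id ]′ (x*y≡0⇒x≡0⊎y≡0 xx≡0))
    from : ∀ {x} → 0# ≡ x → x * x ≡ 0#
    from refl = zeroˡ 0#

  count-roots-nonsquare : ¬ IsSquare u → count (λ x → (x * x) ≟ u) ≡ 0
  count-roots-nonsquare {u} ¬square = count-none (λ x → (x * x) ≟ u) (λ x xx≡u → ¬square (x , xx≡u))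

  nonsquare⇒≢0 : ¬ IsSquare u → u ≢ 0#
  nonsquare⇒≢0 ¬square refl = ¬square (0# , zeroˡ 0#)

  module OddOrder (2∤q : ¬ 2 ∣ q) where

    2#≢0 : 2# ≢ 0#
    2#≢0 2#≡0 = 2∤q (subst (2 ∣_) (count-all U? (λ _ → tt)) (count-involution U? (_+ 1#) +1+1 (λ _ → tt) +1≢id))
      where
      +1+1 : ∀ x → x + 1# + 1# ≡ x
      +1+1 x = trans (+-assoc x 1# 1#) (trans (cong (x +_) 2#≡0) (+-identityʳ x))
      +1≢id : ∀ {x} → ⊤ → x + 1# ≢ x
      +1≢id {x} _ x+1≡x = 1≢0 (+-cancelˡ x 1# 0# (trans x+1≡x (sym (+-identityʳ x))))

    four≢0 : four ≢ 0#
    four≢0 four≡0 = *-≢0 2#≢0 2#≢0 (trans (sym four≡2#*2#) four≡0)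

    -x≡x⇒x≡0 : - x ≡ x → x ≡ 0#
    -x≡x⇒x≡0 {x} -x≡x with x*y≡0⇒x≡0⊎y≡0 (trans (sym x+x≡2#*x) (trans (cong (_+ x) (sym -x≡x)) (-‿inverseˡ x)))
    ... | inj₁ 2#≡0 = contradiction 2#≡0 2#≢0
    ... | inj₂ x≡0  = x≡0

    count-roots-nonzeroSquare : NonzeroSquare u → count (λ x → (x * x) ≟ u) ≡ 2
    count-roots-nonzeroSquare ((t , refl) , 0≢tt) =
      count-pair (λ x → (x * x) ≟ (t * t)) t≢-t (x*x≡y*y⇒y≡x⊎-y≡x , y≡x⊎-y≡x⇒x*x≡y*y)
      where
      t≢-t : t ≢ - t
      t≢-t t≡-t = 0≢tt (sym (trans (cong (λ s → s * s) (-x≡x⇒x≡0 (sym t≡-t))) (zeroˡ 0#)))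

    count-roots : ∀ u → count (λ x → (x * x) ≟ u) ≡ indicator (0# ≟ u) ℕ.+ 2 ℕ.* indicator (nonzeroSquare? u)
    count-roots u = by-cases (0# ≟ u) (square? u)
      where
      by-cases : (0≟u : Dec (0# ≡ u)) (square?u : Dec (IsSquare u)) →
        count (λ x → (x * x) ≟ u) ≡ indicator 0≟u ℕ.+ 2 ℕ.* indicator (square?u ×-dec ¬? 0≟u)
      by-cases (yes refl) (yes _)      = count-roots-0
      by-cases (yes refl) (no _)       = count-roots-0
      by-cases (no 0≢u)   (yes square) = count-roots-nonzeroSquare (square , 0≢u)
      by-cases (no _)     (no ¬square) = count-roots-nonsquare ¬square

    +count-roots≡1+φ : ∀ u → ℤ.+ count (λ x → (x * x) ≟ u) ≡ 1ℤ ℤ.+ φ u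
    +count-roots≡1+φ u = by-cases (0# ≟ u) (square? u)
      where
      by-cases : Dec (0# ≡ u) → Dec (IsSquare u) → ℤ.+ count (λ x → (x * x) ≟ u) ≡ 1ℤ ℤ.+ φ u
      by-cases (yes refl) _           = trans (cong ℤ.+_ count-roots-0) (cong (λ z → 1ℤ ℤ.+ z) (sym φ-0))
      by-cases (no 0≢u) (yes square) = trans (cong ℤ.+_ (count-roots-nonzeroSquare (square , 0≢u))) (cong (λ z → 1ℤ ℤ.+ z) (sym (φ-square (square , 0≢u))))
      by-cases (no _) (no ¬square)   = trans (cong ℤ.+_ (count-roots-nonsquare ¬square)) (cong (λ z → 1ℤ ℤ.+ z) (sym (φ-nonsquare ¬square)))

    #nonzeroSquares : ℕ
    #nonzeroSquares = count nonzeroSquare?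

    q≡1+2*#nonzeroSquares : q ≡ 1 ℕ.+ 2 ℕ.* #nonzeroSquares
    q≡1+2*#nonzeroSquares = begin
      q                                                              ≡⟨ ∑-count-fibres (λ x → x * x) ⟨
      ∑ (λ u → count (λ x → (x * x) ≟ u))                            ≡⟨ ∑-cong count-roots ⟩
      ∑ (λ u → indicator (0# ≟ u) ℕ.+ 2 ℕ.* indicator (nonzeroSquare? u)) ≡⟨ ∑-+ (indicator ∘ (0# ≟_)) (λ u → 2 ℕ.* indicator (nonzeroSquare? u)) ⟩
      count (0# ≟_) ℕ.+ ∑ (λ u → 2 ℕ.* indicator (nonzeroSquare? u))  ≡⟨ cong₂ ℕ._+_ (count-singleton 0#) (∑-*ˡ 2 (indicator ∘ nonzeroSquare?)) ⟩
      1 ℕ.+ 2 ℕ.* #nonzeroSquares                                     ∎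
      where open ≡-Reasoning

    #nonsquares≡#nonzeroSquares : count (∁? square?) ≡ #nonzeroSquares
    #nonsquares≡#nonzeroSquares = ℕ.+-cancelˡ-≡ (1 ℕ.+ #nonzeroSquares) _ _ (begin
      1 ℕ.+ #nonzeroSquares ℕ.+ count (∁? square?)     ≡⟨ cong (ℕ._+ count (∁? square?)) #squares ⟨
      count square? ℕ.+ count (∁? square?)             ≡⟨ count-complement square? ⟩
      q                                                ≡⟨ q≡1+2*#nonzeroSquares ⟩
      1 ℕ.+ 2 ℕ.* #nonzeroSquares                      ≡⟨ cong (λ s → suc (#nonzeroSquares ℕ.+ s)) (ℕ.+-identityʳ _) ⟩
      1 ℕ.+ #nonzeroSquares ℕ.+ #nonzeroSquares         ∎)
      where
      open ≡-Reasoning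
      #squares : count square? ≡ 1 ℕ.+ #nonzeroSquares
      #squares = trans (count-split square? (0# ≟_))
        (cong (ℕ._+ #nonzeroSquares) (trans (count-cong (square? ∩? (0# ≟_)) (0# ≟_) (proj₂ , λ { refl → (0# , zeroˡ 0#) , refl }))
                                            (count-singleton 0#)))

    -- u * _ maps the nonzero squares injectively into the nonsquares, which are equally many,
    -- so every nonsquare w is hit: u * w is a square.
    nonsquare*nonsquare : ¬ IsSquare u → ¬ IsSquare w → IsSquare (u * w)
    nonsquare*nonsquare {u} {w} ¬square-u ¬square-w = proj₁ (⊆∧count-≡⇒⊇ (nonzeroSquare? ∘ (u *_)) (∁? square?) square-u*⇒nonsquare
      (trans (count-∘-bijection nonzeroSquare? (u *_) (u ⁻¹ *_) (λ _ → x*[x⁻¹*y]≡y u≢0) (λ _ → x⁻¹*[x*y]≡y u≢0))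
             (sym #nonsquares≡#nonzeroSquares))
      ¬square-w)
      where
      u≢0 : u ≢ 0#
      u≢0 = nonsquare⇒≢0 ¬square-u
      square-u*⇒nonsquare : ∀ {x} → NonzeroSquare (u * x) → ¬ IsSquare x
      square-u*⇒nonsquare {x} (square-ux , 0≢ux) square-x =
        ¬square-u (square-*-cancelʳ (square-x , λ { refl → 0≢ux (sym (zeroʳ u)) }) square-ux)

    φ-* : ∀ u w → φ (u * w) ≡ φ u ℤ.* φ w
    φ-* u w = by-cases (0# ≟ u) (0# ≟ w) (square? u) (square? w)
      where
      nonzero : 0# ≢ u → 0# ≢ w → 0# ≢ u * w
      nonzero 0≢u 0≢w 0≡uw = *-≢0 (0≢u ∘ sym) (0≢w ∘ sym) (sym 0≡uw)
      by-cases : Dec (0# ≡ u) → Dec (0# ≡ w) → Dec (IsSquare u) → Dec (IsSquare w) → φ (u * w) ≡ φ u ℤ.* φ w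
      by-cases (yes refl) _ _ _ = trans (cong φ (zeroˡ w)) (trans φ-0 (sym (trans (cong (ℤ._* φ w) φ-0) (ℤ.*-zeroˡ (φ w)))))
      by-cases (no _) (yes refl) _ _ = trans (cong φ (zeroʳ u)) (trans φ-0 (sym (trans (cong (φ u ℤ.*_) φ-0) (ℤ.*-zeroʳ (φ u)))))
      by-cases (no 0≢u) (no 0≢w) (yes su) (yes sw) =
        trans (φ-square (square-* su sw , nonzero 0≢u 0≢w)) (sym (cong₂ ℤ._*_ (φ-square (su , 0≢u)) (φ-square (sw , 0≢w))))
      by-cases (no 0≢u) (no 0≢w) (yes su) (no ¬sw) =
        trans (φ-nonsquare (λ suw → ¬sw (square-*-cancelʳ (su , 0≢u) (subst IsSquare (*-comm u w) suw))))
              (sym (cong₂ ℤ._*_ (φ-square (su , 0≢u)) (φ-nonsquare ¬sw)))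
      by-cases (no 0≢u) (no 0≢w) (no ¬su) (yes sw) =
        trans (φ-nonsquare (λ suw → ¬su (square-*-cancelʳ (sw , 0≢w) suw)))
              (sym (cong₂ ℤ._*_ (φ-nonsquare ¬su) (φ-square (sw , 0≢w))))
      by-cases (no 0≢u) (no 0≢w) (no ¬su) (no ¬sw) =
        trans (φ-square (nonsquare*nonsquare ¬su ¬sw , nonzero 0≢u 0≢w))
              (sym (cong₂ ℤ._*_ (φ-nonsquare ¬su) (φ-nonsquare ¬sw)))

    φ-*-square : ∀ u {t} → t ≢ 0# → φ (u * (t * t)) ≡ φ u
    φ-*-square u {t} t≢0 = begin
      φ (u * (t * t))     ≡⟨ φ-* u (t * t) ⟩
      φ u ℤ.* φ (t * t)   ≡⟨ cong (φ u ℤ.*_) (φ-square ((t , refl) , λ 0≡tt → *-≢0 t≢0 t≢0 (sym 0≡tt))) ⟩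
      φ u ℤ.* 1ℤ          ≡⟨ ℤ.*-identityʳ (φ u) ⟩
      φ u                 ∎
      where open ≡-Reasoning

    square[-1]⇒2∣#nonzeroSquares : IsSquare (- 1#) → 2 ∣ #nonzeroSquares
    square[-1]⇒2∣#nonzeroSquares square-1 = count-involution nonzeroSquare? -_ -‿involutive negate fixed
      where
      negate : ∀ {x} → NonzeroSquare x → NonzeroSquare (- x)
      negate {x} (square-x , 0≢x) = subst IsSquare (-1*x≈-x x) (square-* square-1 square-x) , λ 0≡-x → -x≢0 (0≢x ∘ sym) (sym 0≡-x)
      fixed : ∀ {x} → NonzeroSquare x → - x ≢ x
      fixed (_ , 0≢x) -x≡x = 0≢x (sym (-x≡x⇒x≡0 -x≡x))

    #nonzeroSquares≢1 : ℕ
    #nonzeroSquares≢1 = count (nonzeroSquare? ∩? ∁? (1# ≟_))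

    #nonzeroSquares≡1+#nonzeroSquares≢1 : #nonzeroSquares ≡ 1 ℕ.+ #nonzeroSquares≢1
    #nonzeroSquares≡1+#nonzeroSquares≢1 = trans (count-split nonzeroSquare? (1# ≟_))
      (cong (ℕ._+ #nonzeroSquares≢1)
            (trans (count-cong (nonzeroSquare? ∩? (1# ≟_)) (1# ≟_) (proj₂ , λ { refl → ((1# , *-identityʳ 1#) , 0≢1) , refl }))
                   (count-singleton 1#)))

    nonsquare[-1]⇒2∣#nonzeroSquares≢1 : ¬ IsSquare (- 1#) → 2 ∣ #nonzeroSquares≢1
    nonsquare[-1]⇒2∣#nonzeroSquares≢1 ¬square-1 = count-involution (nonzeroSquare? ∩? ∁? (1# ≟_)) _⁻¹ (λ _ → ⁻¹-involutive) invert fixed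
      where
      invert : ∀ {x} → (NonzeroSquare ∩ ∁ (1# ≡_)) x → (NonzeroSquare ∩ ∁ (1# ≡_)) (x ⁻¹)
      invert {x} ((square-x , 0≢x) , 1≢x) =
        ( (square-*-cancelʳ (square-x , 0≢x) (1# , trans (*-identityʳ 1#) (sym (x⁻¹*x≡1 (0≢x ∘ sym))))
          , λ 0≡x⁻¹ → x⁻¹≢0 (0≢x ∘ sym) (sym 0≡x⁻¹))
        , λ 1≡x⁻¹ → 1≢x (trans (sym 1⁻¹≡1) (trans (cong _⁻¹ 1≡x⁻¹) ⁻¹-involutive)))
      fixed : ∀ {x} → (NonzeroSquare ∩ ∁ (1# ≡_)) x → x ⁻¹ ≢ x
      fixed {x} ((square-x , 0≢x) , 1≢x) x⁻¹≡x with x*x≡y*y⇒y≡x⊎-y≡x (trans (trans (cong (x *_) (sym x⁻¹≡x)) (x*x⁻¹≡1 (0≢x ∘ sym))) (sym (*-identityʳ 1#)))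
      ... | inj₁ 1≡x  = 1≢x 1≡x
      ... | inj₂ -1≡x = ¬square-1 (subst IsSquare (sym -1≡x) square-x)

    square[-1]⇒q%4≡1 : IsSquare (- 1#) → q ℕ.% 4 ≡ 1
    square[-1]⇒q%4≡1 square-1 with square[-1]⇒2∣#nonzeroSquares square-1
    ... | divides h S≡h*2 = begin
      q ℕ.% 4                               ≡⟨ cong (ℕ._% 4) q≡1+2*#nonzeroSquares ⟩
      (1 ℕ.+ 2 ℕ.* #nonzeroSquares) ℕ.% 4   ≡⟨ cong (λ s → (1 ℕ.+ 2 ℕ.* s) ℕ.% 4) S≡h*2 ⟩
      (1 ℕ.+ 2 ℕ.* (h ℕ.* 2)) ℕ.% 4         ≡⟨ [1+2*[h*2]]%4≡1 h ⟩
      1                                     ∎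
      where open ≡-Reasoning

    nonsquare[-1]⇒q%4≡3 : ¬ IsSquare (- 1#) → q ℕ.% 4 ≡ 3
    nonsquare[-1]⇒q%4≡3 ¬square-1 with nonsquare[-1]⇒2∣#nonzeroSquares≢1 ¬square-1
    ... | divides h S′≡h*2 = begin
      q ℕ.% 4                                  ≡⟨ cong (ℕ._% 4) q≡1+2*#nonzeroSquares ⟩
      (1 ℕ.+ 2 ℕ.* #nonzeroSquares) ℕ.% 4      ≡⟨ cong (λ s → (1 ℕ.+ 2 ℕ.* s) ℕ.% 4) #nonzeroSquares≡1+#nonzeroSquares≢1 ⟩
      (1 ℕ.+ 2 ℕ.* (1 ℕ.+ #nonzeroSquares≢1)) ℕ.% 4
                                               ≡⟨ cong (λ s → (1 ℕ.+ 2 ℕ.* (1 ℕ.+ s)) ℕ.% 4) S′≡h*2 ⟩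
      (1 ℕ.+ 2 ℕ.* (1 ℕ.+ h ℕ.* 2)) ℕ.% 4      ≡⟨ [1+2*[1+h*2]]%4≡3 h ⟩
      3                                        ∎
      where open ≡-Reasoning

    φ[-1]≡1 : q ℕ.% 4 ≡ 1 → φ (- 1#) ≡ 1ℤ
    φ[-1]≡1 q%4≡1 with square? (- 1#)
    ... | yes square-1  = φ-square (square-1 , λ 0≡-1 → -x≢0 1≢0 (sym 0≡-1))
    ... | no ¬square-1 = contradiction (trans (sym q%4≡1) (nonsquare[-1]⇒q%4≡3 ¬square-1)) λ ()

    φ[-1]≡-1 : q ℕ.% 4 ≡ 3 → φ (- 1#) ≡ -1ℤ
    φ[-1]≡-1 q%4≡3 with square? (- 1#)
    ... | yes square-1  = contradiction (trans (sym q%4≡3) (square[-1]⇒q%4≡1 square-1)) λ ()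
    ... | no ¬square-1 = φ-nonsquare ¬square-1

    module Curve (a b c d e f : Carrier) (a≢0 : a ≢ 0#) (c≢0 : c ≢ 0#) (d≢0 : d ≢ 0#) (e≢0 : e ≢ 0#)
                 (af≡ce : a * f ≡ c * e) (cc≡-4ab : c * c ≡ - (four * a * b)) (ab≡de : a * b ≡ d * e) where

      L R B : Carrier → Carrier → Carrier
      L x y = a * (y * y) + b * (x * x) + c * x * y
      R x y = d + e * (x * x) * (y * y) + f * (x * x * x) * y
      B x y = four * a * e * (y * y) + four * c * e * (x * y) + c * c

      -- 4ae (L - R) = (a - e x²) B up to multiples of c c + 4ab, d e - a b and a f - c e, rearranged
      -- so that no subtraction occurs (it is then a semiring identity).
      curve-identity : ∀ x y →
        four * a * e * L x y + e * (x * x) * B x y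
          + (a * (c * c + four * a * b) + four * a * (d * e) + four * e * (x * x * x) * y * (a * f))
        ≡ four * a * e * R x y + a * B x y
          + (e * (x * x) * (c * c + four * a * b) + four * a * (a * b) + four * e * (x * x * x) * y * (c * e))
      curve-identity x y = solve 9 (λ a b c d e f x y k →
          k :* a :* e :* (a :* (y :* y) :+ b :* (x :* x) :+ c :* x :* y)
            :+ e :* (x :* x) :* (k :* a :* e :* (y :* y) :+ k :* c :* e :* (x :* y) :+ c :* c)
            :+ (a :* (c :* c :+ k :* a :* b) :+ k :* a :* (d :* e) :+ k :* e :* (x :* x :* x) :* y :* (a :* f))
          := k :* a :* e :* (d :+ e :* (x :* x) :* (y :* y) :+ f :* (x :* x :* x) :* y)
            :+ a :* (k :* a :* e :* (y :* y) :+ k :* c :* e :* (x :* y) :+ c :* c)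
            :+ (e :* (x :* x) :* (c :* c :+ k :* a :* b) :+ k :* a :* (a :* b) :+ k :* e :* (x :* x :* x) :* y :* (c :* e)))
        refl a b c d e f x y four

      curve-factorisation : ∀ x y → four * a * e * L x y + e * (x * x) * B x y ≡ four * a * e * R x y + a * B x y
      curve-factorisation x y = +-cancelʳ _ _ _ (trans (cong (four * a * e * L x y + e * (x * x) * B x y +_) (sym corrections-agree)) (curve-identity x y))
        where
        cc+4ab≡0 : c * c + four * a * b ≡ 0#
        cc+4ab≡0 = trans (cong (_+ four * a * b) cc≡-4ab) (-‿inverseˡ (four * a * b))
        corrections-agree :
          a * (c * c + four * a * b) + four * a * (d * e) + four * e * (x * x * x) * y * (a * f)
          ≡ e * (x * x) * (c * c + four * a * b) + four * a * (a * b) + four * e * (x * x * x) * y * (c * e)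
        corrections-agree = cong₂ _+_
          (cong₂ _+_ (trans (cong (a *_) cc+4ab≡0) (trans (zeroʳ a) (sym (trans (cong (e * (x * x) *_) cc+4ab≡0) (zeroʳ _)))))
                     (cong (four * a *_) (sym ab≡de)))
          (cong (four * e * (x * x * x) * y *_) af≡ce)

      4ae≢0 : four * a * e ≢ 0#
      4ae≢0 = *-≢0 (*-≢0 four≢0 a≢0) e≢0

      on-curve⇒ : ∀ {x y} → L x y ≡ R x y → e * (x * x) ≡ a ⊎ B x y ≡ 0#
      on-curve⇒ {x} {y} L≡R = *-cancelʳ-⊎ (+-cancelˡ (four * a * e * R x y) _ _
        (trans (cong (λ l → four * a * e * l + e * (x * x) * B x y) (sym L≡R)) (curve-factorisation x y)))

      on-curve⇐ : ∀ {x y} → e * (x * x) ≡ a ⊎ B x y ≡ 0# → L x y ≡ R x y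
      on-curve⇐ {x} {y} ex²≡a⊎B≡0 = *-cancelˡ-≢0 4ae≢0 (+-cancelʳ (a * B x y) _ _
        (trans (cong (four * a * e * L x y +_) (sym (ex²B≡aB ex²≡a⊎B≡0))) (curve-factorisation x y)))
        where
        ex²B≡aB : e * (x * x) ≡ a ⊎ B x y ≡ 0# → e * (x * x) * B x y ≡ a * B x y
        ex²B≡aB (inj₁ ex²≡a) = cong (_* B x y) ex²≡a
        ex²B≡aB (inj₂ B≡0)   = trans (cong (e * (x * x) *_) B≡0) (trans (zeroʳ (e * (x * x))) (sym (trans (cong (a *_) B≡0) (zeroʳ a))))

      B-square : ∀ {x} y → e * (x * x) ≡ a → B x y ≡ (2# * e * x * y + c) * (2# * e * x * y + c)
      B-square {x} y ex²≡a = begin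
        four * a * e * (y * y) + four * c * e * (x * y) + c * c
          ≡⟨ cong (λ a → four * a * e * (y * y) + four * c * e * (x * y) + c * c) (sym ex²≡a) ⟩
        four * (e * (x * x)) * e * (y * y) + four * c * e * (x * y) + c * c
          -- four and 2# are numerals here (not atoms as in curve-identity): the identity needs four = 2# * 2#.
          ≡⟨ solve 4 (λ e x y c → let two = con 1 :+ con 1 in
                (two :+ con 1 :+ con 1) :* (e :* (x :* x)) :* e :* (y :* y) :+ (two :+ con 1 :+ con 1) :* c :* e :* (x :* y) :+ c :* c
                := (two :* e :* x :* y :+ c) :* (two :* e :* x :* y :+ c)) refl e x y c ⟩
        (2# * e * x * y + c) * (2# * e * x * y + c) ∎
        where open ≡-Reasoning

      count-B-row : ∀ {x} → e * (x * x) ≡ a → count (λ y → B x y ≟ 0#) ≡ 1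
      count-B-row {x} ex²≡a = trans (count-cong (λ y → B x y ≟ 0#) (λ y → (2# * e * x * y + c) ≟ 0#) (to , from))
                                    (count-linear-roots c 2ex≢0)
        where
        2ex≢0 : 2# * e * x ≢ 0#
        2ex≢0 = *-≢0 (*-≢0 2#≢0 e≢0) λ { refl → a≢0 (trans (sym ex²≡a) (trans (cong (e *_) (zeroˡ 0#)) (zeroʳ e))) }
        to : ∀ {y} → B x y ≡ 0# → 2# * e * x * y + c ≡ 0#
        to {y} B≡0 = [ id , id ]′ (x*y≡0⇒x≡0⊎y≡0 (trans (sym (B-square y ex²≡a)) B≡0))
        from : ∀ {y} → 2# * e * x * y + c ≡ 0# → B x y ≡ 0#
        from {y} β≡0 = trans (B-square y ex²≡a) (trans (cong (λ β → β * β) β≡0) (zeroˡ 0#))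

      count-B-column : ∀ y → count (λ x → B x y ≟ 0#) ≡ indicator (∁? (0# ≟_) y)
      count-B-column y with 0# ≟ y
      ... | yes refl = count-none (λ x → B x 0# ≟ 0#) (λ x B≡0 → *-≢0 c≢0 c≢0 (trans (sym (B[x,0]≡cc x)) B≡0))
        where
        B[x,0]≡cc : ∀ x → B x 0# ≡ c * c
        B[x,0]≡cc x = solve 5 (λ k a e c x → k :* a :* e :* (con 0 :* con 0) :+ k :* c :* e :* (x :* con 0) :+ c :* c := c :* c) refl four a e c x
      ... | no 0≢y = trans (count-cong (λ x → B x y ≟ 0#) (λ x → (four * c * e * y * x + (four * a * e * (y * y) + c * c)) ≟ 0#)
                                       (trans (sym (B-linear _)) , trans (B-linear _)))
                           (count-linear-roots _ (*-≢0 (*-≢0 (*-≢0 four≢0 c≢0) e≢0) (0≢y ∘ sym)))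
        where
        B-linear : ∀ x → B x y ≡ four * c * e * y * x + (four * a * e * (y * y) + c * c)
        B-linear x = solve 6 (λ k a c e x y → k :* a :* e :* (y :* y) :+ k :* c :* e :* (x :* y) :+ c :* c
                                           := k :* c :* e :* y :* x :+ (k :* a :* e :* (y :* y) :+ c :* c)) refl four a c e x y

      count-row : ∀ x → count (λ y → L x y ≟ R x y) ≡ count (λ y → B x y ≟ 0#) ℕ.+ #nonzero ℕ.* indicator ((e * (x * x)) ≟ a)
      count-row x with (e * (x * x)) ≟ a
      ... | yes ex²≡a = begin
        count (λ y → L x y ≟ R x y)                   ≡⟨ count-all (λ y → L x y ≟ R x y) (λ y → on-curve⇐ (inj₁ ex²≡a)) ⟩
        q                                             ≡⟨ q≡1+#nonzero ⟩
        1 ℕ.+ #nonzero                                ≡⟨ cong₂ ℕ._+_ (count-B-row ex²≡a) (ℕ.*-identityʳ #nonzero) ⟨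
        count (λ y → B x y ≟ 0#) ℕ.+ #nonzero ℕ.* 1   ∎
        where open ≡-Reasoning
      ... | no ex²≢a = begin
        count (λ y → L x y ≟ R x y)                   ≡⟨ count-cong (λ y → L x y ≟ R x y) (λ y → B x y ≟ 0#) (on-row , on-curve⇐ ∘ inj₂) ⟩
        count (λ y → B x y ≟ 0#)                      ≡⟨ ℕ.+-identityʳ _ ⟨
        count (λ y → B x y ≟ 0#) ℕ.+ 0                ≡⟨ cong (count (λ y → B x y ≟ 0#) ℕ.+_) (ℕ.*-zeroʳ #nonzero) ⟨
        count (λ y → B x y ≟ 0#) ℕ.+ #nonzero ℕ.* 0   ∎
        where
        open ≡-Reasoning
        on-row : ∀ {y} → L x y ≡ R x y → B x y ≡ 0#
        on-row L≡R = [ flip contradiction ex²≢a , id ]′ (on-curve⇒ L≡R)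

      #C≡#nonzero+#nonzero*#[ex²≡a] : #C a b c d e f ≡ #nonzero ℕ.+ #nonzero ℕ.* count (λ x → (e * (x * x)) ≟ a)
      #C≡#nonzero+#nonzero*#[ex²≡a] = begin
        #C a b c d e f
          ≡⟨ length-filter-elements² _ ⟩
        ∑ (λ x → count (λ y → L x y ≟ R x y))
          ≡⟨ ∑-cong count-row ⟩
        ∑ (λ x → count (λ y → B x y ≟ 0#) ℕ.+ #nonzero ℕ.* indicator ((e * (x * x)) ≟ a))
          ≡⟨ ∑-+ (λ x → count (λ y → B x y ≟ 0#)) (λ x → #nonzero ℕ.* indicator ((e * (x * x)) ≟ a)) ⟩
        ∑ (λ x → count (λ y → B x y ≟ 0#)) ℕ.+ ∑ (λ x → #nonzero ℕ.* indicator ((e * (x * x)) ≟ a))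
          ≡⟨ cong₂ ℕ._+_ (trans (∑-swap (λ x y → indicator (B x y ≟ 0#))) (∑-cong count-B-column))
                         (∑-*ˡ #nonzero (λ x → indicator ((e * (x * x)) ≟ a))) ⟩
        #nonzero ℕ.+ #nonzero ℕ.* count (λ x → (e * (x * x)) ≟ a)
          ∎
        where open ≡-Reasoning

      #[ex²≡a]≡#[x²≡ae] : count (λ x → (e * (x * x)) ≟ a) ≡ count (λ y → (y * y) ≟ (a * e))
      #[ex²≡a]≡#[x²≡ae] = trans (count-cong (λ x → (e * (x * x)) ≟ a) (λ x → ((e * x) * (e * x)) ≟ (a * e)) (to , from))
                                 (count-∘-bijection (λ y → (y * y) ≟ (a * e)) (e *_) (e ⁻¹ *_) (λ _ → x*[x⁻¹*y]≡y e≢0) (λ _ → x⁻¹*[x*y]≡y e≢0))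
        where
        ex*ex≡ex²*e : ∀ x → (e * x) * (e * x) ≡ e * (x * x) * e
        ex*ex≡ex²*e x = solve 2 (λ e x → (e :* x) :* (e :* x) := e :* (x :* x) :* e) refl e x
        to : ∀ {x} → e * (x * x) ≡ a → (e * x) * (e * x) ≡ a * e
        to {x} ex²≡a = trans (ex*ex≡ex²*e x) (cong (_* e) ex²≡a)
        from : ∀ {x} → (e * x) * (e * x) ≡ a * e → e * (x * x) ≡ a
        from {x} ex*ex≡ae = [ id , flip contradiction e≢0 ]′ (*-cancelʳ-⊎ (trans (sym (ex*ex≡ex²*e x)) ex*ex≡ae))

      φ[ae]≡φ[-1]*φ[ad] : φ (a * e) ≡ φ (- 1#) ℤ.* φ (a * d)
      φ[ae]≡φ[-1]*φ[ad] = begin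
        φ (a * e)                              ≡⟨ φ-*-square (a * e) (*-≢0 2#≢0 d≢0) ⟨
        φ (a * e * (2# * d * (2# * d)))        ≡⟨ cong φ ae[2d]²≡-ad*cc ⟩
        φ (- 1# * (a * d) * (c * c))           ≡⟨ φ-*-square (- 1# * (a * d)) c≢0 ⟩
        φ (- 1# * (a * d))                     ≡⟨ φ-* (- 1#) (a * d) ⟩
        φ (- 1#) ℤ.* φ (a * d)                 ∎
        where
        open ≡-Reasoning
        ae[2d]²≡-ad*cc : a * e * (2# * d * (2# * d)) ≡ - 1# * (a * d) * (c * c)
        ae[2d]²≡-ad*cc = begin
          a * e * (2# * d * (2# * d))          ≡⟨ solve 4 (λ a d e t → a :* e :* (t :* d :* (t :* d)) := t :* t :* a :* d :* (d :* e)) refl a d e 2# ⟩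
          2# * 2# * a * d * (d * e)            ≡⟨ cong₂ (λ k s → k * a * d * s) (sym four≡2#*2#) (sym ab≡de) ⟩
          four * a * d * (a * b)               ≡⟨ solve 4 (λ a b d k → k :* a :* d :* (a :* b) := a :* d :* (k :* a :* b)) refl a b d four ⟩
          a * d * (four * a * b)               ≡⟨ -x*-y≡x*y ⟨
          - (a * d) * - (four * a * b)         ≡⟨ cong₂ _*_ (-1*x≈-x (a * d)) cc≡-4ab ⟨
          - 1# * (a * d) * (c * c)             ∎

      +#C≡[q-1][2+φ[-1]φ[ad]] : ℤ.+ #C a b c d e f ≡ (ℤ.+ q ℤ.- 1ℤ) ℤ.* (ℤ.+ 2 ℤ.+ φ (- 1#) ℤ.* φ (a * d))
      +#C≡[q-1][2+φ[-1]φ[ad]] = trans (cong ℤ.+_ #C≡#nonzero+#nonzero*#[ex²≡a])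
        (+[k+k*m]≡[q-1]*[2+z] (φ (- 1#) ℤ.* φ (a * d)) q≡1+#nonzero
          (trans (cong ℤ.+_ #[ex²≡a]≡#[x²≡ae]) (trans (+count-roots≡1+φ (a * e)) (cong (λ z → 1ℤ ℤ.+ z) φ[ae]≡φ[-1]*φ[ad]))))

open import Data.Integer using (+_)

corollary1p5 : (p r : ℕ) → Prime p → ¬ (p ≡ 2) → 1 ≤ r →
    (F : FiniteField (p ^ r)) →
    let open FiniteField F in
    (a b c d e f : Carrier) →
    ¬ (a ≡ 0#) → ¬ (b ≡ 0#) → ¬ (c ≡ 0#) → ¬ (d ≡ 0#) → ¬ (e ≡ 0#) → ¬ (f ≡ 0#) →
    a * f ≡ c * e → c * c ≡ - (four * a * b) → a * b ≡ d * e →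
    ((p ^ r) % 4 ≡ 1 →
      + #C a b c d e f ≡ (+ (2 ℕ.* (p ^ r)) ℤ.- + 2) ℤ.+ (+ (p ^ r) ℤ.- + 1) ℤ.* φ (a * d))
    × ((p ^ r) % 4 ≡ 3 →
      + #C a b c d e f ≡ (+ (2 ℕ.* (p ^ r)) ℤ.- + 2) ℤ.- (+ (p ^ r) ℤ.- + 1) ℤ.* φ (a * d))
corollary1p5 p r p-prime p≢2 _ F a b c d e f a≢0 _ c≢0 d≢0 e≢0 _ af≡ce cc≡-4ab ab≡de =
    (λ q%4≡1 → trans (#C-via (φ[-1]≡1 q%4≡1)) ([q-1]*[2+z]≡[2q-2]+[q-1]*z (p ^ r) (φ (a * d))))
  , (λ q%4≡3 → trans (#C-via (φ[-1]≡-1 q%4≡3)) ([q-1]*[2-z]≡[2q-2]-[q-1]*z (p ^ r) (φ (a * d))))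
  where
  open FiniteField F using (φ; #C; _*_; -_; 1#)
  open FiniteFieldProperties F using (module OddOrder)
  open OddOrder (prime≢2⇒2∤p^r p-prime p≢2 r) using (φ[-1]≡1; φ[-1]≡-1; module Curve)
  open Curve a b c d e f a≢0 c≢0 d≢0 e≢0 af≡ce cc≡-4ab ab≡de using (+#C≡[q-1][2+φ[-1]φ[ad]])
  #C-via : ∀ {s} → φ (- 1#) ≡ s → + #C a b c d e f ≡ (+ (p ^ r) ℤ.- 1ℤ) ℤ.* (+ 2 ℤ.+ s ℤ.* φ (a * d))
  #C-via {s} φ[-1]≡s = trans +#C≡[q-1][2+φ[-1]φ[ad]] (cong (λ t → (+ (p ^ r) ℤ.- 1ℤ) ℤ.* (+ 2 ℤ.+ t ℤ.* φ (a * d))) φ[-1]≡s)
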